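{- Let $n\ge 3$ and $k\ge1$. If there exist $k$ mutually orthogonal latin squares of order $n$, then there exists a linear intersecting $(n+2)$-partite hypergraph $H$ with $\tau(H)=k+1$ such that no side of $H$ and no subset of a line of $H$ is a minimal cover of $H$.
   Context: A hypergraph $H$ is a set of non-empty subsets (lines) of a finite vertex set $V(H)$, every vertex lying on at least one line. $H$ is $r$-partite if $V(H)$ is partitioned into $r$ sets (sides) such that every line contains exactly one vertex from each side. A cover is a set of vertices meeting every line; $\tau(H)$ is the minimum size of a cover, and a minimal cover here means a cover of size $\tau(H)$. $H$ is intersecting if every two lines share at least one vertex, and linear if every two distinct lines share at most one vertex. A latin square of order $n$ is an $n\times n$ array on $n$ symbols with each symbol exactly once in each row and column; two latin squares of order $n$ are orthogonal if superimposing them yields each of the $n^2$ ordered pairs of symbols exactly once; a set of latin squares is mutually orthogonal if every pair in it is orthogonal. -}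

module Defs where

open import Data.Nat using (ℕ; suc; _≤_)
open import Data.Fin using (Fin; _≟_)
open import Data.Fin.Subset using (Subset; _∈_; _⊆_; ∣_∣; Nonempty)
open import Data.Vec using (tabulate)
open import Data.Product using (Σ; ∃; _×_)
open import Relation.Binary.PropositionalEquality using (_≡_; _≢_)
open import Relation.Nullary using (¬_)
open import Relation.Nullary.Decidable using (⌊_⌋)

record LatinSquare (n : ℕ) : Set where
  field
    cell   : Fin n → Fin n → Fin n
    row-ex  : ∀ r s → ∃ λ c → cell r c ≡ s
    row-un  : ∀ r c c' → cell r c ≡ cell r c' → c ≡ c'
    col-ex  : ∀ c s → ∃ λ r → cell r c ≡ s
    col-un  : ∀ c r r' → cell r c ≡ cell r' c → r ≡ r'
open LatinSquare public

Orthogonal : ∀ {n} → LatinSquare n → LatinSquare n → Set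
Orthogonal {n} A B =
  (∀ (a b : Fin n) → ∃ λ r → ∃ λ c → cell A r c ≡ a × cell B r c ≡ b) ×
  (∀ (r c r' c' : Fin n) → cell A r c ≡ cell A r' c' → cell B r c ≡ cell B r' c' →
     r ≡ r' × c ≡ c')

MOLS : ℕ → ℕ → Set
MOLS k n = Σ (Fin k → LatinSquare n) λ L → ∀ i j → i ≢ j → Orthogonal (L i) (L j)

-- Hypergraphs on vertex set Fin m; lines indexed by Fin nLines, pairwise
-- distinct (so the family represents a set of lines).

record Hypergraph (m : ℕ) : Set where
  field
    nLines    : ℕ
    line      : Fin nLines → Subset m
    nonempty  : ∀ i → Nonempty (line i)
    distinct  : ∀ i j → line i ≡ line j → i ≡ j
    covered   : ∀ (v : Fin m) → ∃ λ i → v ∈ line i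
open Hypergraph public

module _ {m : ℕ} (H : Hypergraph m) where

  IsPartite : (r : ℕ) → (Fin m → Fin r) → Set
  IsPartite r side =
    ∀ i (s : Fin r) →
      (∃ λ v → v ∈ line H i × side v ≡ s) ×
      (∀ v w → v ∈ line H i → w ∈ line H i → side v ≡ s → side w ≡ s → v ≡ w)

  Intersecting : Set
  Intersecting = ∀ i j → ∃ λ v → v ∈ line H i × v ∈ line H j

  Linear : Set
  Linear = ∀ i j → i ≢ j → ∀ v w →
    v ∈ line H i → v ∈ line H j → w ∈ line H i → w ∈ line H j → v ≡ w

  IsCover : Subset m → Set
  IsCover C = ∀ i → ∃ λ v → v ∈ C × v ∈ line H i

  CoverNumber : ℕ → Set
  CoverNumber t = (∃ λ C → IsCover C × ∣ C ∣ ≡ t) × (∀ C → IsCover C → t ≤ ∣ C ∣)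

  MinimalCover : Subset m → Set
  MinimalCover C = IsCover C × (∀ D → IsCover D → ∣ C ∣ ≤ ∣ D ∣)

sideSet : ∀ {m r} → (Fin m → Fin r) → Fin r → Subset m
sideSet side s = tabulate (λ v → ⌊ side v ≟ s ⌋)

module Submission where

-- Let L₁,…,L_k be mutually orthogonal latin
-- squares of order n ≥ 3.  Row, column and the k squares give k+2 pairwise
-- orthogonal coordinates on the n² cells; the first k+1 of them define parallel
-- classes of lines (all their level sets except row 0), the last one is used to
-- define the sides.  Each class c gets a point at infinity ∞ c on all its lines and
-- every line d gets a private point own d.  The hypergraph has n+2 sides: one side
-- for each value of the last coordinate, and two extra sides P and Q.
--
-- Then the construction is checked: each line has
-- one point per side, lines of one class meet at infinity and lines of different
-- classes in one cell (linear, intersecting); the k+1 points at infinity form a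
-- cover and every cover has k+1 points (τ = k+1); every side has k+2 points; and a
-- cover inside a line must contain n+1 points.  lemma3p4 assembles these.

open import Defs
open import Data.Bool.Properties using (T-≡)
open import Data.Nat using (ℕ; zero; suc; _+_; _*_; _≤_; z≤n; s≤s; s≤s⁻¹)
open import Data.Nat.Properties using (≤-trans; +-identityʳ; 1+n≰n)
open import Data.Fin using (Fin; zero; suc; _↑ˡ_; inject₁; fromℕ; punchOut; _≟_)
open import Data.Fin.Properties
  using (+↔⊎; *↔×; fromℕ≢inject₁; inject₁-injective; punchOut-injective; 0≢1+n; injective⇒≤; all?; ¬∀⟶∃¬; suc-injective)
open import Data.Fin.Subset using (Subset; _∈_; _∉_; _⊆_; ∣_∣; inside; outside; ⊤; ⊥)
open import Data.Fin.Subset.Properties using (_∈?_; ∈⊤; ∣⊤∣≡n; ∣⊥∣≡0)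
open import Data.Vec using ([]; _∷_; tabulate; _++_; here; there)
open import Data.Vec.Properties using ([]=⇒lookup; lookup⇒[]=; lookup∘tabulate)
open import Data.Vec.Functional using () renaming (_∷_ to _◃_)
open import Data.Product using (Σ; ∃; _×_; _,_; proj₁; proj₂)
open import Data.Product.Properties using (×-≡,≡→≡) renaming (≡-dec to Σ-≡-dec)
open import Data.Sum using (_⊎_; inj₁; inj₂)
open import Data.Sum.Properties using () renaming (≡-dec to ⊎-≡-dec)
open import Data.Sum.Function.Propositional using (_⊎-↔_)
open import Data.Empty using (⊥-elim)
open import Function using (_∘_)
open import Function.Bundles using (_↔_; Inverse; Injection; Equivalence)
open import Function.Definitions using (Injective)
open import Function.Properties.Inverse using (↔-refl; ↔-trans; ↔-sym; Inverse⇒Injection)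
open import Relation.Binary.Definitions using (DecidableEquality)
open import Relation.Binary.PropositionalEquality using (_≡_; _≢_; refl; sym; trans; cong; cong₂; subst)
open import Relation.Nullary using (¬_; Dec; yes; no)
open import Relation.Nullary.Decidable using (⌊_⌋; toWitness; fromWitness)

select : ∀ {m} {P : Fin m → Set} → (∀ v → Dec (P v)) → Subset m
select P? = tabulate (λ v → ⌊ P? v ⌋)

∈-select⁻ : ∀ {m} {P : Fin m → Set} (P? : ∀ v → Dec (P v)) {v} → v ∈ select P? → P v
∈-select⁻ P? {v} v∈ =
  toWitness (Equivalence.from T-≡ (trans (sym (lookup∘tabulate (λ w → ⌊ P? w ⌋) v)) ([]=⇒lookup v∈)))

∈-select⁺ : ∀ {m} {P : Fin m → Set} (P? : ∀ v → Dec (P v)) {v} → P v → v ∈ select P?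
∈-select⁺ P? {v} p =
  lookup⇒[]= v _ (trans (lookup∘tabulate (λ w → ⌊ P? w ⌋) v) (Equivalence.to T-≡ (fromWitness p)))

rank : ∀ {m} (C : Subset m) {x} → x ∈ C → Fin ∣ C ∣
rank (inside ∷ C) here = zero
rank (inside ∷ C) (there x∈C) = suc (rank C x∈C)
rank (outside ∷ C) (there x∈C) = rank C x∈C

rank-injective : ∀ {m} (C : Subset m) {x y} (x∈C : x ∈ C) (y∈C : y ∈ C) →
                 rank C x∈C ≡ rank C y∈C → x ≡ y
rank-injective (inside ∷ C) here here _ = refl
rank-injective (inside ∷ C) here (there _) ()
rank-injective (inside ∷ C) (there _) here ()
rank-injective (inside ∷ C) (there x∈C) (there y∈C) e = cong suc (rank-injective C x∈C y∈C (suc-injective e))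
rank-injective (outside ∷ C) (there x∈C) (there y∈C) e = cong suc (rank-injective C x∈C y∈C e)

≤-card : ∀ {a m} (C : Subset m) (f : Fin a → Fin m) → Injective _≡_ _≡_ f → (∀ i → f i ∈ C) → a ≤ ∣ C ∣
≤-card C f f-inj f∈C = injective⇒≤ {f = λ i → rank C (f∈C i)} (f-inj ∘ rank-injective C (f∈C _) (f∈C _))

∣p++q∣ : ∀ {a b} (p : Subset a) (q : Subset b) → ∣ p ++ q ∣ ≡ ∣ p ∣ + ∣ q ∣
∣p++q∣ [] q = refl
∣p++q∣ (inside ∷ p) q = cong suc (∣p++q∣ p q)
∣p++q∣ (outside ∷ p) q = ∣p++q∣ p q

↑ˡ-∈-++ : ∀ {a b} {p : Subset a} (q : Subset b) {x} → x ∈ p → x ↑ˡ b ∈ p ++ q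
↑ˡ-∈-++ q here = here
↑ˡ-∈-++ q (there x∈p) = there (↑ˡ-∈-++ q x∈p)

◃-injective : ∀ {a} {X : Set} (x : X) (f : Fin a → X) →
              Injective _≡_ _≡_ f → (∀ i → f i ≢ x) → Injective _≡_ _≡_ (x ◃ f)
◃-injective x f f-inj new {zero} {zero} _ = refl
◃-injective x f f-inj new {zero} {suc j} e = ⊥-elim (new j (sym e))
◃-injective x f f-inj new {suc i} {zero} e = ⊥-elim (new i e)
◃-injective x f f-inj new {suc i} {suc j} e = cong suc (f-inj e)

another : ∀ {k} → 2 ≤ k → (j : Fin k) → ∃ λ j' → j' ≢ j
another {suc (suc _)} _ zero = suc zero , λ ()
another {suc (suc _)} _ (suc _) = zero , λ ()
another {suc zero} (s≤s ()) _

module _ {m} (H : Hypergraph m) where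

  minimal-cover-size : ∀ {t C} → CoverNumber H t → MinimalCover H C → ∣ C ∣ ≤ t
  minimal-cover-size {C = C} ((D , D-cover , ∣D∣≡t) , _) (_ , C-min) = subst (∣ C ∣ ≤_) ∣D∣≡t (C-min D D-cover)

  large-not-minimal : ∀ {t C} → CoverNumber H t → suc t ≤ ∣ C ∣ → ¬ MinimalCover H C
  large-not-minimal τ big min = 1+n≰n (≤-trans big (minimal-cover-size τ min))

-- Two maps f g : X → A are orthogonal when x ↦ (f x , g x) is a bijection X ≃ A × A;
-- meet a b is the unique x with f x = a and g x = b.
record OrthogonalMaps {X A : Set} (f g : X → A) : Set where
  field
    meet   : A → A → X
    meet-f : ∀ a b → f (meet a b) ≡ a
    meet-g : ∀ a b → g (meet a b) ≡ b
    unique : ∀ {x y} → f x ≡ f y → g x ≡ g y → x ≡ y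

  meet-unique : ∀ {a b x} → f x ≡ a → g x ≡ b → meet a b ≡ x
  meet-unique fx gx = unique (trans (meet-f _ _) (sym fx)) (trans (meet-g _ _) (sym gx))

  meet-injectiveˡ : ∀ {a a' b b'} → meet a b ≡ meet a' b' → a ≡ a'
  meet-injectiveˡ {a} {a'} {b} {b'} e = trans (sym (meet-f a b)) (trans (cong f e) (meet-f a' b'))

orthogonal-sym : ∀ {X A : Set} {f g : X → A} → OrthogonalMaps f g → OrthogonalMaps g f
orthogonal-sym f⊥g = record
  { meet = λ a b → meet b a ; meet-f = λ a b → meet-g b a ; meet-g = λ a b → meet-f b a
  ; unique = λ gx fx → unique fx gx }
  where open OrthogonalMaps f⊥g

module LatinCoordinates {n k : ℕ} (L : Fin k → LatinSquare n)
                        (L⊥ : ∀ i j → i ≢ j → Orthogonal (L i) (L j)) where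

  Cell : Set
  Cell = Fin n × Fin n

  coord : Fin (2 + k) → Cell → Fin n
  coord zero = proj₁
  coord (suc zero) = proj₂
  coord (suc (suc j)) (r , c) = cell (L j) r c

  rows⊥columns : OrthogonalMaps (coord zero) (coord (suc zero))
  rows⊥columns = record
    { meet = _,_ ; meet-f = λ _ _ → refl ; meet-g = λ _ _ → refl
    ; unique = λ e e' → ×-≡,≡→≡ (e , e') }

  rows⊥square : ∀ j → OrthogonalMaps (coord zero) (coord (suc (suc j)))
  rows⊥square j = record
    { meet = λ r s → r , proj₁ (row-ex (L j) r s) ; meet-f = λ _ _ → refl
    ; meet-g = λ r s → proj₂ (row-ex (L j) r s) ; unique = unique }
    where
    unique : ∀ {x y} → proj₁ x ≡ proj₁ y → coord (suc (suc j)) x ≡ coord (suc (suc j)) y → x ≡ y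
    unique {r , c} {_ , c'} refl e = cong (r ,_) (row-un (L j) r c c' e)

  columns⊥square : ∀ j → OrthogonalMaps (coord (suc zero)) (coord (suc (suc j)))
  columns⊥square j = record
    { meet = λ c s → proj₁ (col-ex (L j) c s) , c ; meet-f = λ _ _ → refl
    ; meet-g = λ c s → proj₂ (col-ex (L j) c s) ; unique = unique }
    where
    unique : ∀ {x y} → proj₂ x ≡ proj₂ y → coord (suc (suc j)) x ≡ coord (suc (suc j)) y → x ≡ y
    unique {r , c} {r' , _} refl e = cong (_, c) (col-un (L j) c r r' e)

  squares⊥ : ∀ {i j} → i ≢ j → OrthogonalMaps (coord (suc (suc i))) (coord (suc (suc j)))
  squares⊥ {i} {j} i≢j = record
    { meet = λ a b → proj₁ (pairs a b) , proj₁ (proj₂ (pairs a b))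
    ; meet-f = λ a b → proj₁ (proj₂ (proj₂ (pairs a b)))
    ; meet-g = λ a b → proj₂ (proj₂ (proj₂ (pairs a b)))
    ; unique = λ {x} {y} e e' → ×-≡,≡→≡ (pair-unique (proj₁ x) (proj₂ x) (proj₁ y) (proj₂ y) e e') }
    where
    pairs : ∀ a b → ∃ λ r → ∃ λ c → cell (L i) r c ≡ a × cell (L j) r c ≡ b
    pairs = proj₁ (L⊥ i j i≢j)

    pair-unique : ∀ r c r' c' → cell (L i) r c ≡ cell (L i) r' c' → cell (L j) r c ≡ cell (L j) r' c' →
                  r ≡ r' × c ≡ c'
    pair-unique = proj₂ (L⊥ i j i≢j)

  coord⊥ : ∀ {i i'} → i ≢ i' → OrthogonalMaps (coord i) (coord i')
  coord⊥ {zero} {zero} i≢i' = ⊥-elim (i≢i' refl)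
  coord⊥ {zero} {suc zero} _ = rows⊥columns
  coord⊥ {zero} {suc (suc j)} _ = rows⊥square j
  coord⊥ {suc zero} {zero} _ = orthogonal-sym rows⊥columns
  coord⊥ {suc zero} {suc zero} i≢i' = ⊥-elim (i≢i' refl)
  coord⊥ {suc zero} {suc (suc j)} _ = columns⊥square j
  coord⊥ {suc (suc j)} {zero} _ = orthogonal-sym (rows⊥square j)
  coord⊥ {suc (suc j)} {suc zero} _ = orthogonal-sym (columns⊥square j)
  coord⊥ {suc (suc i)} {suc (suc j)} i≢j = squares⊥ (λ i≡j → i≢j (cong (λ j → suc (suc j)) i≡j))

-- There are at most n − 1 mutually orthogonal latin squares of order n ≥ 2: in row 1,
-- square j repeats its top-left symbol in some column c_j ≠ 0, and orthogonality
-- forces the columns c_j to be distinct.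
mols-bound : ∀ {n k} (L : Fin k → LatinSquare (2 + n)) →
             (∀ i j → i ≢ j → Orthogonal (L i) (L j)) → k ≤ suc n
mols-bound {n} {k} L L⊥ = injective⇒≤ {f = λ j → punchOut (column≢0 j)}
  (column-injective ∘ punchOut-injective (column≢0 _) (column≢0 _))
  where
  column : Fin k → Fin (2 + n)
  column j = proj₁ (row-ex (L j) (suc zero) (cell (L j) zero zero))

  column-symbol : ∀ j → cell (L j) (suc zero) (column j) ≡ cell (L j) zero zero
  column-symbol j = proj₂ (row-ex (L j) (suc zero) (cell (L j) zero zero))

  column≢0 : ∀ j → zero ≢ column j
  column≢0 j e with col-un (L j) zero zero (suc zero)
                      (sym (subst (λ c → cell (L j) (suc zero) c ≡ cell (L j) zero zero) (sym e) (column-symbol j)))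
  ... | ()

  column-injective : Injective _≡_ _≡_ column
  column-injective {i} {j} e with i ≟ j
  ... | yes i≡j = i≡j
  ... | no i≢j with proj₂ (L⊥ i j i≢j) zero zero (suc zero) (column i) (sym (column-symbol i))
                      (subst (λ c → cell (L j) zero zero ≡ cell (L j) (suc zero) c) (sym e) (sym (column-symbol j)))
  ...   | () , _

module IncidenceHypergraph
  {Point Line : Set} {m b : ℕ} (points : Fin m ↔ Point) (lines : Fin b ↔ Line)
  (_on_ : Point → Line → Set) (_on?_ : ∀ x d → Dec (x on d))
  (inhabited : ∀ d → ∃ λ x → x on d)
  (covered : ∀ x → ∃ λ d → x on d)
  (extensional : ∀ d d' → (∀ x → x on d → x on d') → (∀ x → x on d' → x on d) → d ≡ d')
  where

  pointAt : Fin m → Point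
  pointAt = Inverse.to points

  index : Point → Fin m
  index = Inverse.from points

  pointAt-index : ∀ x → pointAt (index x) ≡ x
  pointAt-index = Inverse.strictlyInverseˡ points

  index-pointAt : ∀ v → index (pointAt v) ≡ v
  index-pointAt = Inverse.strictlyInverseʳ points

  pointAt-injective : Injective _≡_ _≡_ pointAt
  pointAt-injective = Injection.injective (Inverse⇒Injection points)

  index-injective : Injective _≡_ _≡_ index
  index-injective = Injection.injective (Inverse⇒Injection (↔-sym points))

  lineAt : Fin b → Line
  lineAt = Inverse.to lines

  lineAt-lineIndex : ∀ d → lineAt (Inverse.from lines d) ≡ d
  lineAt-lineIndex = Inverse.strictlyInverseˡ lines

  lineAt-injective : Injective _≡_ _≡_ lineAt
  lineAt-injective = Injection.injective (Inverse⇒Injection lines)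

  pointsOn : Line → Subset m
  pointsOn d = select (λ v → pointAt v on? d)

  ∈⇒on : ∀ {v d} → v ∈ pointsOn d → pointAt v on d
  ∈⇒on {d = d} = ∈-select⁻ (λ v → pointAt v on? d)

  index∈⇒on : ∀ {x d} → index x ∈ pointsOn d → x on d
  index∈⇒on {x} {d} x∈ = subst (_on d) (pointAt-index x) (∈⇒on x∈)

  on⇒index∈ : ∀ {x d} → x on d → index x ∈ pointsOn d
  on⇒index∈ {x} {d} x-on = ∈-select⁺ (λ v → pointAt v on? d) (subst (_on d) (sym (pointAt-index x)) x-on)

  H : Hypergraph m
  H = record
    { nLines = b
    ; line = pointsOn ∘ lineAt
    ; nonempty = λ i → index (proj₁ (inhabited (lineAt i))) , on⇒index∈ (proj₂ (inhabited (lineAt i)))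
    ; distinct = λ i j same → lineAt-injective (extensional (lineAt i) (lineAt j)
        (λ x x-on → index∈⇒on (subst (index x ∈_) same (on⇒index∈ x-on)))
        (λ x x-on → index∈⇒on (subst (index x ∈_) (sym same) (on⇒index∈ x-on))))
    ; covered = λ v → let (d , v-on) = covered (pointAt v) in
        Inverse.from lines d ,
        subst (_∈ pointsOn (lineAt (Inverse.from lines d))) (index-pointAt v)
          (on⇒index∈ (subst (pointAt v on_) (sym (lineAt-lineIndex d)) v-on))
    }

  IsLinearIncidence : Set
  IsLinearIncidence = ∀ d d' → d ≢ d' → ∀ x y → x on d → x on d' → y on d → y on d' → x ≡ y

  linear : IsLinearIncidence → Linear H
  linear lin i j i≢j v w v∈i v∈j w∈i w∈j =
    pointAt-injective (lin (lineAt i) (lineAt j) (i≢j ∘ lineAt-injective) (pointAt v) (pointAt w)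
      (∈⇒on v∈i) (∈⇒on v∈j) (∈⇒on w∈i) (∈⇒on w∈j))

  IsIntersectingIncidence : Set
  IsIntersectingIncidence = ∀ d d' → ∃ λ x → x on d × x on d'

  intersecting : IsIntersectingIncidence → Intersecting H
  intersecting meets i j = let (x , x-on , x-on') = meets (lineAt i) (lineAt j) in
    index x , on⇒index∈ x-on , on⇒index∈ x-on'

  hit : ∀ {C} → IsCover H C → ∀ d → ∃ λ x → x on d × index x ∈ C
  hit {C} cover d with cover (Inverse.from lines d)
  ... | v , v∈C , v∈d =
    pointAt v , subst (pointAt v on_) (lineAt-lineIndex d) (∈⇒on v∈d) ,
    subst (_∈ C) (sym (index-pointAt v)) v∈C

  count : ∀ {a} C (f : Fin a → Point) → Injective _≡_ _≡_ f → (∀ i → index (f i) ∈ C) → a ≤ ∣ C ∣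
  count C f f-inj = ≤-card C (index ∘ f) (f-inj ∘ index-injective)

  -- In a linear structure, a cover C contained in the line d contains every point
  -- of d that lies on a second line d': C meets d' inside d ∩ d' = {x}.
  forced : IsLinearIncidence → ∀ {C d d' x} → IsCover H C → C ⊆ pointsOn d →
           x on d → x on d' → d ≢ d' → index x ∈ C
  forced lin {C} {d} {d'} {x} cover C⊆d x-on x-on' d≢d' with hit cover d'
  ... | y , y-on' , y∈C = subst (λ z → index z ∈ C) (lin d d' d≢d' y x (index∈⇒on (C⊆d y∈C)) y-on' x-on x-on') y∈C

  module Sides {r} {S : Set} (sides : Fin r ↔ S) (side : Point → S) where

    sideIndex : Fin m → Fin r
    sideIndex v = Inverse.from sides (side (pointAt v))

    IsPartiteIncidence : Set
    IsPartiteIncidence = (∀ d σ → ∃ λ x → x on d × side x ≡ σ) ×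
                         (∀ d {x y} → x on d → y on d → side x ≡ side y → x ≡ y)

    sideIndex-index : ∀ {x σ} → side x ≡ σ → sideIndex (index x) ≡ Inverse.from sides σ
    sideIndex-index {x} eq = cong (Inverse.from sides) (trans (cong side (pointAt-index x)) eq)

    partite : IsPartiteIncidence → IsPartite H r sideIndex
    partite (exists , unique) i s =
      let (x , x-on , x-side) = exists (lineAt i) (Inverse.to sides s) in
      (index x , on⇒index∈ x-on , trans (sideIndex-index x-side) (Inverse.strictlyInverseʳ sides s)) ,
      λ v w v∈ w∈ v-side w-side → pointAt-injective (unique (lineAt i) (∈⇒on v∈) (∈⇒on w∈)
        (Injection.injective (Inverse⇒Injection (↔-sym sides)) (trans v-side (sym w-side))))

    side-count : ∀ {a σ} (f : Fin a → Point) → Injective _≡_ _≡_ f → (∀ i → side (f i) ≡ σ) →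
                 a ≤ ∣ sideSet sideIndex (Inverse.from sides σ) ∣
    side-count f f-inj f-side =
      count _ f f-inj (λ i → ∈-select⁺ (λ v → sideIndex v ≟ _) (sideIndex-index (f-side i)))

module Construction (n₃ k′ : ℕ) (L : Fin (suc k′) → LatinSquare (3 + n₃))
                    (L⊥ : ∀ i j → i ≢ j → Orthogonal (L i) (L j)) where

  n₁ n k : ℕ
  n₁ = 2 + n₃
  n = suc n₁
  k = suc k′

  open LatinCoordinates L L⊥

  k≤n₁ : k ≤ n₁
  k≤n₁ = mols-bound L L⊥

  -- Classes of parallel lines: class zero consists of rows.  The last coordinate
  -- (sideCoord) is orthogonal to all class coordinates and labels sides.
  Class : Set
  Class = Fin (suc k)

  classCoord : Class → Cell → Fin n
  classCoord c = coord (inject₁ c)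

  sideCoord : Cell → Fin n
  sideCoord = coord (fromℕ (suc k))

  classes⊥ : ∀ {c c'} → c ≢ c' → OrthogonalMaps (classCoord c) (classCoord c')
  classes⊥ {c} {c'} c≢c' = coord⊥ {inject₁ c} {inject₁ c'} (c≢c' ∘ inject₁-injective)

  class⊥side : ∀ c → OrthogonalMaps (classCoord c) sideCoord
  class⊥side c = coord⊥ {inject₁ c} {fromℕ (suc k)} (λ e → fromℕ≢inject₁ (sym e))

  open OrthogonalMaps

  rows⊥class : ∀ j → OrthogonalMaps (classCoord zero) (classCoord (suc j))
  rows⊥class j = classes⊥ {zero} {suc j} (λ ())

  rows⊥side : OrthogonalMaps (classCoord zero) sideCoord
  rows⊥side = class⊥side zero

  rowClassCell : Fin k → Fin n → Fin n → Cell
  rowClassCell j = meet (rows⊥class j)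

  rowSideCell : Fin n → Fin n → Cell
  rowSideCell = meet rows⊥side

  -- Lines: the rows 1,…,n−1 and all level lines of the classes suc j.
  Line : Set
  Line = Fin n₁ ⊎ (Fin k × Fin n)

  pattern rowLine r = inj₁ r
  pattern classLine j a = inj₂ (j , a)

  class : Line → Class
  class (rowLine _) = zero
  class (classLine j _) = suc j

  value : Line → Fin n
  value (rowLine r) = suc r
  value (classLine _ a) = a

  line-ext : ∀ {d d'} → class d ≡ class d' → value d ≡ value d' → d ≡ d'
  line-ext {rowLine r} {rowLine r'} _ e = cong rowLine (suc-injective e)
  line-ext {classLine j a} {classLine .j a'} refl e = cong (classLine j) e

  _≟ₗ_ : DecidableEquality Line
  _≟ₗ_ = ⊎-≡-dec _≟_ (Σ-≡-dec _≟_ _≟_)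

  Point : Set
  Point = Class ⊎ (Cell ⊎ Line)

  pattern ∞ c = inj₁ c
  pattern pt x = inj₂ (inj₁ x)
  pattern own d = inj₂ (inj₂ d)

  ∞⁺ : Fin k → Point
  ∞⁺ j = ∞ (suc j)

  pt-injective : ∀ {x y : Cell} → _≡_ {A = Point} (pt x) (pt y) → x ≡ y
  pt-injective refl = refl

  infix 4 _on_
  _on_ : Point → Line → Set
  ∞ c on d = class d ≡ c
  pt x on d = classCoord (class d) x ≡ value d
  own d' on d = d' ≡ d

  _on?_ : ∀ x d → Dec (x on d)
  ∞ c on? d = class d ≟ c
  pt x on? d = classCoord (class d) x ≟ value d
  own d' on? d = d' ≟ₗ d

  lineCount pointCount : ℕ
  lineCount = n₁ + k * n
  pointCount = suc k + (n * n + lineCount)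

  lines : Fin lineCount ↔ Line
  lines = ↔-trans +↔⊎ (↔-refl ⊎-↔ *↔×)

  points : Fin pointCount ↔ Point
  points = ↔-trans +↔⊎ (↔-refl ⊎-↔ ↔-trans +↔⊎ (*↔× ⊎-↔ lines))

  -- Every line contains its private point, which lies on no other line; every point
  -- lies on some line.
  on-some-line : ∀ x → ∃ λ d → x on d
  on-some-line (∞ zero) = rowLine zero , refl
  on-some-line (∞ (suc j)) = classLine j zero , refl
  on-some-line (pt (r , c)) = classLine zero c , refl
  on-some-line (own d) = d , refl

  open IncidenceHypergraph points lines _on_ _on?_ (λ d → own d , refl) on-some-line
    (λ d d' d⊆d' _ → d⊆d' (own d) refl) public

  same-class-meet : ∀ {d d' x} → d ≢ d' → class d ≡ class d' → x on d → x on d' → x ≡ ∞ (class d)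
  same-class-meet {x = ∞ c} _ _ x-on _ = cong ∞ (sym x-on)
  same-class-meet {d} {d'} {pt x} d≢d' same x-on x-on' =
    ⊥-elim (d≢d' (line-ext same (trans (sym x-on) (trans (cong (λ c → classCoord c x) same) x-on'))))
  same-class-meet {x = own _} d≢d' _ refl refl = ⊥-elim (d≢d' refl)

  cross-meet : ∀ {d d' x} (ne : class d ≢ class d') → x on d → x on d' →
               x ≡ pt (meet (classes⊥ ne) (value d) (value d'))
  cross-meet {x = ∞ c} ne x-on x-on' = ⊥-elim (ne (trans x-on (sym x-on')))
  cross-meet {x = pt x} ne x-on x-on' = cong pt (sym (meet-unique (classes⊥ ne) x-on x-on'))
  cross-meet {x = own _} ne refl refl = ⊥-elim (ne refl)

  linear-incidence : IsLinearIncidence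
  linear-incidence d d' d≢d' x y x-on x-on' y-on y-on' with class d ≟ class d'
  ... | yes same = trans (same-class-meet d≢d' same x-on x-on') (sym (same-class-meet d≢d' same y-on y-on'))
  ... | no ne = trans (cross-meet ne x-on x-on') (sym (cross-meet ne y-on y-on'))

  intersecting-incidence : IsIntersectingIncidence
  intersecting-incidence d d' with class d ≟ class d'
  ... | yes same = ∞ (class d) , refl , sym same
  ... | no ne = pt (meet (classes⊥ ne) (value d) (value d')) , meet-f (classes⊥ ne) _ _ , meet-g (classes⊥ ne) _ _

  Side : Set
  Side = Fin n ⊎ Fin 2

  pattern sideAt e = inj₁ e
  pattern P = inj₂ zero
  pattern Q = inj₂ (suc zero)

  sides : Fin (n + 2) ↔ Side
  sides = +↔⊎

  -- Row-0 cells go to P; ∞ 0 to P, the other points at infinity and the private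
  -- points of rows to Q; the private point of classLine j a takes the side of the
  -- row-0 cell of that line, which is missing from it.
  side : Point → Side
  side (∞ zero) = P
  side (∞ (suc _)) = Q
  side (pt (zero , _)) = P
  side (pt (suc r , c)) = sideAt (sideCoord (suc r , c))
  side (own (rowLine _)) = Q
  side (own (classLine j a)) = sideAt (sideCoord (rowClassCell j zero a))

  side-cell : ∀ x → proj₁ x ≢ zero → side (pt x) ≡ sideAt (sideCoord x)
  side-cell (zero , _) nonzero = ⊥-elim (nonzero refl)
  side-cell (suc _ , _) _ = refl

  side-row-0 : ∀ x → proj₁ x ≡ zero → side (pt x) ≡ P
  side-row-0 (zero , _) _ = refl

  -- The point of line d on side σ.  On classLine j a the side of the missing row-0
  -- cell is occupied by the private point.
  pointOf : Line → Side → Point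
  pointOf (rowLine r) (sideAt e) = pt (rowSideCell (suc r) e)
  pointOf (rowLine r) P = ∞ zero
  pointOf (rowLine r) Q = own (rowLine r)
  pointOf (classLine j a) (sideAt e) with e ≟ sideCoord (rowClassCell j zero a)
  ... | yes _ = own (classLine j a)
  ... | no _ = pt (meet (class⊥side (suc j)) a e)
  pointOf (classLine j a) P = pt (rowClassCell j zero a)
  pointOf (classLine j a) Q = ∞ (suc j)

  pointOf-on : ∀ d σ → pointOf d σ on d
  pointOf-on (rowLine r) (sideAt e) = meet-f rows⊥side (suc r) e
  pointOf-on (rowLine r) P = refl
  pointOf-on (rowLine r) Q = refl
  pointOf-on (classLine j a) (sideAt e) with e ≟ sideCoord (rowClassCell j zero a)
  ... | yes _ = refl
  ... | no _ = meet-f (class⊥side (suc j)) a e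
  pointOf-on (classLine j a) P = meet-g (rows⊥class j) zero a
  pointOf-on (classLine j a) Q = refl

  side-pointOf : ∀ d σ → side (pointOf d σ) ≡ σ
  side-pointOf (rowLine r) (sideAt e) =
    trans (side-cell _ (λ row≡0 → 0≢1+n (trans (sym row≡0) (meet-f rows⊥side (suc r) e))))
          (cong sideAt (meet-g rows⊥side (suc r) e))
  side-pointOf (rowLine r) P = refl
  side-pointOf (rowLine r) Q = refl
  side-pointOf (classLine j a) (sideAt e) with e ≟ sideCoord (rowClassCell j zero a)
  ... | yes e≡ = cong sideAt (sym e≡)
  ... | no e≢ = trans (side-cell y not-row-0) (cong sideAt (meet-g (class⊥side (suc j)) a e))
    where
    y : Cell
    y = meet (class⊥side (suc j)) a e
    -- the only cell of the line in row 0 is rowClassCell j zero a, whose side coordinate is not e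
    not-row-0 : proj₁ y ≢ zero
    not-row-0 row≡0 = e≢ (trans (sym (meet-g (class⊥side (suc j)) a e))
      (cong sideCoord (sym (meet-unique (rows⊥class j) row≡0 (meet-f (class⊥side (suc j)) a e)))))
  side-pointOf (classLine j a) P = side-row-0 _ (meet-f (rows⊥class j) zero a)
  side-pointOf (classLine j a) Q = refl

  -- Every point of d is the point of d on its own side.  (A cell of classLine j a
  -- outside row 0 cannot share the side coordinate of the row-0 cell of the line.)
  pointOf-side : ∀ {x d} → x on d → pointOf d (side x) ≡ x
  pointOf-side {∞ zero} {rowLine r} refl = refl
  pointOf-side {∞ (suc j)} {classLine .j a} refl = refl
  pointOf-side {pt (.(suc r) , c)} {rowLine r} refl = cong pt (meet-unique rows⊥side refl refl)
  pointOf-side {pt (zero , c)} {classLine j a} x-on = cong pt (meet-unique (rows⊥class j) refl x-on)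
  pointOf-side {pt (suc r , c)} {classLine j a} x-on with sideCoord (suc r , c) ≟ sideCoord (rowClassCell j zero a)
  ... | no _ = cong pt (meet-unique (class⊥side (suc j)) x-on refl)
  ... | yes same-side with unique (class⊥side (suc j)) (trans x-on (sym (meet-g (rows⊥class j) zero a))) same-side
  ...   | x≡ with trans (cong proj₁ x≡) (meet-f (rows⊥class j) zero a)
  ...     | ()
  pointOf-side {own (rowLine r)} refl = refl
  pointOf-side {own (classLine j a)} refl with sideCoord (rowClassCell j zero a) ≟ sideCoord (rowClassCell j zero a)
  ... | yes _ = refl
  ... | no ne = ⊥-elim (ne refl)

  open Sides sides side public

  partite-incidence : IsPartiteIncidence
  partite-incidence =
    (λ d σ → pointOf d σ , pointOf-on d σ , side-pointOf d σ) ,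
    λ d {x} {y} x-on y-on same → trans (sym (pointOf-side x-on)) (trans (cong (pointOf d) same) (pointOf-side y-on))

  C∞ : Subset pointCount
  C∞ = ⊤ {suc k} ++ ⊥ {n * n + lineCount}

  ∣C∞∣ : ∣ C∞ ∣ ≡ suc k
  ∣C∞∣ = trans (∣p++q∣ (⊤ {suc k}) (⊥ {n * n + lineCount}))
               (trans (cong₂ _+_ (∣⊤∣≡n (suc k)) (∣⊥∣≡0 (n * n + lineCount))) (+-identityʳ (suc k)))

  C∞-cover : IsCover H C∞
  C∞-cover i = index (∞ (class (lineAt i))) , ↑ˡ-∈-++ ⊥ (∈⊤ {x = class (lineAt i)}) , on⇒index∈ {∞ (class (lineAt i))} refl

  -- If C misses ∞ (suc j), the n lines of class suc j are hit in n distinct points of C.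
  missing-∞ : ∀ {C j} → IsCover H C → index (∞ (suc j)) ∉ C → n ≤ ∣ C ∣
  missing-∞ {C} {j} cover ∞∉C = count C hitPoint hitPoint-injective (λ a → proj₂ (proj₂ (hits a)))
    where
    hits : ∀ a → ∃ λ x → x on classLine j a × index x ∈ C
    hits a = hit cover (classLine j a)

    hitPoint : Fin n → Point
    hitPoint a = proj₁ (hits a)

    hitPoint-injective : Injective _≡_ _≡_ hitPoint
    hitPoint-injective {a} {b} same with a ≟ b
    ... | yes a≡b = a≡b
    ... | no a≢b = ⊥-elim (∞∉C (subst (λ x → index x ∈ C) at-∞ (proj₂ (proj₂ (hits a)))))
      where
      at-∞ : hitPoint a ≡ ∞ (suc j)
      at-∞ = same-class-meet (λ { refl → a≢b refl }) refl (proj₁ (proj₂ (hits a)))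
               (subst (_on classLine j b) (sym same) (proj₁ (proj₂ (hits b))))

  -- If C contains every ∞ (suc j), row line 0 still needs a further point of C.
  all-∞ : ∀ {C} → IsCover H C → (∀ j → index (∞ (suc j)) ∈ C) → suc k ≤ ∣ C ∣
  all-∞ {C} cover ∞∈C =
    count C (x₀ ◃ ∞⁺) (◃-injective x₀ ∞⁺ (λ { refl → refl }) ∞≢x₀)
      λ { zero → proj₂ (proj₂ (hit cover (rowLine zero))) ; (suc j) → ∞∈C j }
    where
    x₀ : Point
    x₀ = proj₁ (hit cover (rowLine zero))

    ∞≢x₀ : ∀ j → ∞ (suc j) ≢ x₀
    ∞≢x₀ j e with subst (_on rowLine zero) (sym e) (proj₁ (proj₂ (hit cover (rowLine zero))))
    ... | ()

  -- Every cover has at least k+1 points (using n ≥ k+1 in the first case).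
  τ-lower : ∀ C → IsCover H C → suc k ≤ ∣ C ∣
  τ-lower C cover with all? (λ j → index (∞ (suc j)) ∈? C)
  ... | yes all∈ = all-∞ cover all∈
  ... | no ¬all = ≤-trans (s≤s k≤n₁) (missing-∞ cover (proj₂ (¬∀⟶∃¬ k _ (λ j → index (∞ (suc j)) ∈? C) ¬all)))

  cover-number : CoverNumber H (suc k)
  cover-number = (C∞ , C∞-cover , ∣C∞∣) , τ-lower

  side-size : ∀ σ → suc (suc k) ≤ ∣ sideSet sideIndex (Inverse.from sides σ) ∣
  side-size (sideAt e) = side-count f f-injective f-side
    where
    -- the row-0 cell with side coordinate e; the private point of each class line
    -- through it has side e
    z : Cell
    z = rowSideCell zero e

    privates : Fin k → Point
    privates j = own (classLine j (classCoord (suc j) z))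

    f : Fin (2 + k) → Point
    f = pointOf (rowLine zero) (sideAt e) ◃ (pointOf (rowLine (suc zero)) (sideAt e) ◃ privates)

    rows-differ : pointOf (rowLine (suc zero)) (sideAt e) ≢ pointOf (rowLine zero) (sideAt e)
    rows-differ eq with meet-injectiveˡ rows⊥side {suc (suc zero)} {suc zero} (pt-injective eq)
    ... | ()

    f-injective : Injective _≡_ _≡_ f
    f-injective = ◃-injective _ _ (◃-injective _ _ (λ { refl → refl }) (λ _ ()))
                    λ { zero → rows-differ ; (suc _) → λ () }

    f-side : ∀ i → side (f i) ≡ sideAt e
    f-side zero = side-pointOf (rowLine zero) (sideAt e)
    f-side (suc zero) = side-pointOf (rowLine (suc zero)) (sideAt e)
    f-side (suc (suc j)) = cong sideAt (trans (cong sideCoord (meet-unique (rows⊥class j) (meet-f rows⊥side zero e) refl))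
                                              (meet-g rows⊥side zero e))
  side-size P = ≤-trans (s≤s (s≤s k≤n₁)) (side-count f f-injective f-side)
    where
    f : Fin (suc n) → Point
    f = ∞ zero ◃ λ c → pt (zero , c)

    f-injective : Injective _≡_ _≡_ f
    f-injective = ◃-injective _ _ (λ { refl → refl }) (λ _ ())

    f-side : ∀ i → side (f i) ≡ P
    f-side zero = refl
    f-side (suc _) = refl
  side-size Q = side-count f f-injective f-side
    where
    -- the private points of rows 1 and 2, and the points at infinity ∞ (suc j)
    f : Fin (2 + k) → Point
    f = own (rowLine zero) ◃ (own (rowLine (suc zero)) ◃ ∞⁺)

    f-injective : Injective _≡_ _≡_ f
    f-injective = ◃-injective _ _ (◃-injective _ _ (λ { refl → refl }) (λ _ ()))
                    λ { zero → λ () ; (suc _) → λ () }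

    f-side : ∀ i → side (f i) ≡ Q
    f-side zero = refl
    f-side (suc zero) = refl
    f-side (suc (suc _)) = refl

  sides-not-minimal : ∀ s → ¬ MinimalCover H (sideSet sideIndex s)
  sides-not-minimal s = subst (λ s → ¬ MinimalCover H (sideSet sideIndex s)) (Inverse.strictlyInverseʳ sides s)
    (large-not-minimal H cover-number (side-size (Inverse.to sides s)))

  parallel : ∀ d → ∃ λ d' → d ≢ d' × class d' ≡ class d
  parallel (rowLine zero) = rowLine (suc zero) , (λ ()) , refl
  parallel (rowLine (suc _)) = rowLine zero , (λ ()) , refl
  parallel (classLine j zero) = classLine j (suc zero) , (λ ()) , refl
  parallel (classLine j (suc _)) = classLine j zero , (λ ()) , refl

  -- A cover inside d contains ∞ (class d), the only point d shares with a parallel line.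
  ∞-forced : ∀ {C} d → IsCover H C → C ⊆ pointsOn d → index (∞ (class d)) ∈ C
  ∞-forced d cover C⊆d =
    let (d' , d≢d' , same) = parallel d in forced linear-incidence {d = d} {d'} {x = ∞ (class d)} cover C⊆d refl same d≢d'

  -- A cover of size ≤ k+1 inside a line d contains ∞ (class d) and n cells of d, each
  -- shared with another line.
  line-cover-large : ∀ d {C} → IsCover H C → C ⊆ pointsOn d → ∣ C ∣ ≤ suc k → suc n ≤ ∣ C ∣
  line-cover-large (rowLine r) {C} cover C⊆d _ =
    count C (∞ zero ◃ λ c → pt (suc r , c)) (◃-injective _ _ (λ { refl → refl }) (λ _ ()))
      λ { zero → ∞-forced (rowLine r) cover C⊆d
        ; (suc c) → forced linear-incidence {d = rowLine r} {classLine zero c} {pt (suc r , c)} cover C⊆d refl refl (λ ()) }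
  line-cover-large (classLine j a) {C} cover C⊆d small =
    count C (∞ (suc j) ◃ cells) (◃-injective _ _ cells-injective (λ _ ())) (λ { zero → ∞-forced d cover C⊆d ; (suc r) → all-cells r })
    where
    d : Line
    d = classLine j a

    cells : Fin n → Point
    cells r = pt (rowClassCell j r a)

    cells-injective : Injective _≡_ _≡_ cells
    cells-injective eq = meet-injectiveˡ (rows⊥class j) (pt-injective eq)

    -- the cells outside row 0 lie on row lines ...
    row-cells : ∀ r → index (cells (suc r)) ∈ C
    row-cells r = forced linear-incidence {d = d} {rowLine r} {cells (suc r)} cover C⊆d
      (meet-g (rows⊥class j) (suc r) a) (meet-f (rows⊥class j) (suc r) a) (λ ())

    -- ... so n − 1 ≤ k, and a second class suc j' of class lines exists ...
    2≤k : 2 ≤ k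
    2≤k = ≤-trans (s≤s (s≤s z≤n)) (s≤s⁻¹ (≤-trans
      (count C (∞ (suc j) ◃ (cells ∘ suc)) (◃-injective _ _ (suc-injective ∘ cells-injective) (λ _ ()))
        λ { zero → ∞-forced d cover C⊆d ; (suc r) → row-cells r })
      small))

    -- ... whose lines take care of all n cells of d
    all-cells : ∀ r → index (cells r) ∈ C
    all-cells r = let (j' , j'≢j) = another 2≤k j in
      forced linear-incidence {d = d} {classLine j' (classCoord (suc j') (rowClassCell j r a))} {cells r} cover C⊆d
        (meet-g (rows⊥class j) r a) refl (λ eq → j'≢j (sym (suc-injective (cong class eq))))

  -- A minimal cover has at most k+1 ≤ n points, so it cannot lie inside a line.
  lines-not-minimal : ∀ d C → C ⊆ pointsOn d → ¬ MinimalCover H C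
  lines-not-minimal d C C⊆d minimal@(cover , _) =
    1+n≰n (≤-trans (line-cover-large d cover C⊆d small) (≤-trans small (s≤s k≤n₁)))
    where
    small : ∣ C ∣ ≤ suc k
    small = minimal-cover-size H cover-number minimal

lemma3p4 : (n k : ℕ) → 3 ≤ n → 1 ≤ k → MOLS k n →
    Σ ℕ λ m → Σ (Hypergraph m) λ H → Σ (Fin m → Fin (n + 2)) λ side →
    IsPartite H (n + 2) side × Linear H × Intersecting H ×
    CoverNumber H (suc k) ×
    (∀ (s : Fin (n + 2)) → ¬ MinimalCover H (sideSet side s)) ×
    (∀ (i : Fin (nLines H)) (C : Subset m) → C ⊆ line H i → ¬ MinimalCover H C)
lemma3p4 (suc (suc (suc n₃))) (suc k′) _ _ (L , L⊥) =
  pointCount , H , sideIndex ,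
  partite partite-incidence , linear linear-incidence , intersecting intersecting-incidence ,
  cover-number , sides-not-minimal , lines-not-minimal ∘ lineAt
  where open Construction n₃ k′ L L⊥
lemma3p4 (suc (suc (suc _))) zero _ () _
lemma3p4 (suc (suc zero)) _ (s≤s (s≤s ())) _ _
lemma3p4 (suc zero) _ (s≤s ()) _ _
lemma3p4 zero _ () _ _
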